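{- For any commutative ring $K$ with unity, $\ker l^*=\mathcal{L}_K(A)^{\perp}$, where $\mathcal{L}_K(A)^\perp=\{P\in K\langle A\rangle:(P,Q)=0\text{ for all }Q\in\mathcal{L}_K(A)\}$.
   Context: $A$ is a finite alphabet, $K\langle A\rangle$ the free associative algebra over $K$ with scalar product $(P,Q)=\sum_w(P,w)(Q,w)$, $(P,w)$ the coefficient of word $w$. $\mathcal{L}_K(A)$ is the Lie subalgebra (bracket $[P,Q]=PQ-QP$) generated by $A$. The left normed bracketing: $l(\epsilon)=0$, $l(a)=a$, $l(ua)=[l(u),a]$, extended linearly; $l^*$ is the $K$-linear endomorphism of $K\langle A\rangle$ with $(l^*(u),v)=(l(v),u)$ for all words $u,v$. -}

module Defs where

open import Level using (_⊔_)
open import Algebra.Bundles using (CommutativeRing)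
open import Data.Nat using (ℕ; zero; suc)
open import Data.Fin using (Fin)
open import Data.Fin.Properties using () renaming (_≟_ to _≟ᶠ_)
open import Data.List using (List; []; _∷_; _++_; map; concatMap; length; allFin)
open import Data.List.Properties using (≡-dec)
open import Data.Product using (_×_; _,_)
open import Data.Bool using (if_then_else_)
open import Relation.Nullary using (does)

Word : ℕ → Set
Word n = List (Fin n)

_≟w_ : ∀ {n} (u v : Word n) → _
_≟w_ = ≡-dec _≟ᶠ_

wordsOfLength : ∀ n → ℕ → List (Word n)
wordsOfLength n zero = [] ∷ []
wordsOfLength n (suc k) = concatMap (λ a → map (a ∷_) (wordsOfLength n k)) (allFin n)

module _ {c ℓ} (K : CommutativeRing c ℓ) (n : ℕ) where
  open CommutativeRing K

  -- Elements of K⟨A⟩, represented as finite formal K-linear combinations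
  -- of words; equality is coefficientwise (see _≈ₚ_ below).
  Poly : Set c
  Poly = List (Carrier × Word n)

  coeff : Poly → Word n → Carrier
  coeff [] w = 0#
  coeff ((d , u) ∷ P) w = (if does (u ≟w w) then d else 0#) + coeff P w

  _≈ₚ_ : Poly → Poly → Set ℓ
  P ≈ₚ Q = ∀ w → coeff P w ≈ coeff Q w

  word : Word n → Poly
  word w = (1# , w) ∷ []

  zeroₚ : Poly
  zeroₚ = []

  _+ₚ_ : Poly → Poly → Poly
  P +ₚ Q = P ++ Q

  _·ₚ_ : Carrier → Poly → Poly
  d ·ₚ P = map (λ { (e , u) → (d * e , u) }) P

  _*ₚ_ : Poly → Poly → Poly
  P *ₚ Q = concatMap (λ { (d , u) → map (λ { (e , v) → (d * e , u ++ v) }) Q }) P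

  bracket : Poly → Poly → Poly
  bracket P Q = (P *ₚ Q) +ₚ ((- 1#) ·ₚ (Q *ₚ P))

  -- scalar product (P,Q) = Σ_w (P,w)(Q,w)
  ⟪_,_⟫ : Poly → Poly → Carrier
  ⟪ [] , Q ⟫ = 0#
  ⟪ (d , u) ∷ P , Q ⟫ = d * coeff Q u + ⟪ P , Q ⟫

  -- membership in L_K(A): the Lie subalgebra (K-submodule closed under the
  -- bracket) generated by A, as the least such predicate.
  data InLie : Poly → Set (c ⊔ ℓ) where
    gen   : (a : Fin n) → InLie (word (a ∷ []))
    zer   : InLie zeroₚ
    add   : ∀ {P Q} → InLie P → InLie Q → InLie (P +ₚ Q)
    smul  : ∀ {P} (d : Carrier) → InLie P → InLie (d ·ₚ P)
    brk   : ∀ {P Q} → InLie P → InLie Q → InLie (bracket P Q)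
    resp  : ∀ {P Q} → P ≈ₚ Q → InLie P → InLie Q

  -- left normed bracketing on words: l(ε)=0, l(a)=a, l(ua)=[l(u),a]
  lAux : Poly → Word n → Poly
  lAux P [] = P
  lAux P (a ∷ w) = lAux (bracket P (word (a ∷ []))) w

  l : Word n → Poly
  l [] = zeroₚ
  l (a ∷ w) = lAux (word (a ∷ [])) w

  -- l* on words: l*(u) = Σ_v (l(v),u) v.  Since l(v) is homogeneous of
  -- degree |v|, only v with |v| = |u| contribute; so (l*(u),v) = (l(v),u).
  lstarWord : Word n → Poly
  lstarWord u = map (λ v → (coeff (l v) u , v)) (wordsOfLength n (length u))

  lstar : Poly → Poly
  lstar P = concatMap (λ { (d , u) → d ·ₚ lstarWord u }) P

  InKerLstar : Poly → Set ℓ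
  InKerLstar P = lstar P ≈ₚ zeroₚ

  InLiePerp : Poly → Set (c ⊔ ℓ)
  InLiePerp P = ∀ Q → InLie Q → ⟪ P , Q ⟫ ≈ 0#

-- Proof idea: for words u, v one has (l*(u), v) = (l(v), u), since l(v) is homogeneous of
-- degree |v| and l*(u) ranges over the words of length |u|; so P ∈ ker l* iff P is orthogonal
-- to every l(v). Each l(v) lies in L_K(A), and conversely the K-span of the l(v) is closed
-- under the bracket: by the Jacobi identity [X,[Z,a]] = [[X,Z],a] − [[X,a],Z] and induction
-- along left-normed words, [X, l(v)] is in the span whenever X is. Hence the span contains
-- L_K(A), and orthogonality to all l(v) is orthogonality to L_K(A).

module Submission where

open import Algebra.Bundles using (AbelianGroup; CommutativeRing; CommutativeMonoid)
open import Data.Bool using (true; false; if_then_else_)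
open import Data.Fin using (Fin; punchIn)
open import Data.Fin.Properties using (punchInᵢ≢i) renaming (_≟_ to _≟ᶠ_)
open import Data.List using (List; []; _∷_; _++_; map; concat; concatMap; length; take; drop; tabulate; allFin)
open import Data.List.Properties
  using (++-assoc; length-++; ∷-injectiveʳ; map-tabulate; map-concatMap; concatMap-cong)
open import Data.List.Relation.Unary.All using (All; []; _∷_)
open import Data.List.Relation.Unary.All.Properties using (++⁺; concat⁺; gmap⁺)
open import Data.Nat as ℕ using (ℕ; suc)
import Data.Nat.Properties as ℕ
open import Data.Product using (_×_; _,_; proj₁; proj₂)
open import Function using (_∘_; id)
open import Level using (_⊔_)
open import Relation.Binary.PropositionalEquality as ≡ using (_≡_; _≢_)
open import Relation.Nullary using (Dec; does; yes; no)
open import Relation.Nullary.Negation using (contradiction)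

open import Defs
  using (Word; _≟w_; wordsOfLength; Poly; InLie; gen; zer; add; smul; brk; resp; InKerLstar; InLiePerp)
import Defs as D

module _ {a} {A : Set a} where

  drop-length-++ : ∀ (xs ys : List A) → drop (length xs) (xs ++ ys) ≡ ys
  drop-length-++ []       ys = ≡.refl
  drop-length-++ (x ∷ xs) ys = drop-length-++ xs ys

  take-length-++ : ∀ (xs ys : List A) → take (length xs) (xs ++ ys) ≡ xs
  take-length-++ []       ys = ≡.refl
  take-length-++ (x ∷ xs) ys = ≡.cong (x ∷_) (take-length-++ xs ys)

  ++≡⇒≡drop : ∀ xs {ys zs : List A} → xs ++ ys ≡ zs → ys ≡ drop (length xs) zs
  ++≡⇒≡drop xs {ys} ≡.refl = ≡.sym (drop-length-++ xs ys)

  ++≡⇒≡take : ∀ {xs} (ys : List A) {zs} → xs ++ ys ≡ zs → xs ≡ take (length zs ℕ.∸ length ys) zs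
  ++≡⇒≡take {xs} ys ≡.refl = ≡.sym (begin
    take (length (xs ++ ys) ℕ.∸ length ys) (xs ++ ys)
      ≡⟨ ≡.cong (λ k → take (k ℕ.∸ length ys) (xs ++ ys)) (length-++ xs) ⟩
    take (length xs ℕ.+ length ys ℕ.∸ length ys) (xs ++ ys)
      ≡⟨ ≡.cong (λ k → take k (xs ++ ys)) (ℕ.m+n∸n≡m (length xs) (length ys)) ⟩
    take (length xs) (xs ++ ys)
      ≡⟨ take-length-++ xs ys ⟩
    xs ∎)
    where open ≡.≡-Reasoning

module SumProperties {c ℓ} (M : CommutativeMonoid c ℓ) where

  open CommutativeMonoid M renaming (ε to 0#; _∙_ to _+_; ∙-congˡ to +-congˡ; identityʳ to +-identityʳ)
  open import Algebra.Properties.CommutativeMonoid.Sum M using (sum; sum-remove; sum-cong-≋; sum-replicate-zero)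

  sum-zero : ∀ {m} (t : Fin m → Carrier) → (∀ i → t i ≈ 0#) → sum t ≈ 0#
  sum-zero {m} t t≈0 = trans (sum-cong-≋ t≈0) (sum-replicate-zero m)

  sum-single : ∀ {m} (t : Fin m → Carrier) b → (∀ i → i ≢ b → t i ≈ 0#) → sum t ≈ t b
  sum-single {suc m} t b others≈0 = trans (sum-remove {i = b} t) (trans
    (+-congˡ (sum-zero (t ∘ punchIn b) (λ j → others≈0 (punchIn b j) (punchInᵢ≢i b j))))
    (+-identityʳ (t b)))

module AbelianGroupProperties {c ℓ} (G : AbelianGroup c ℓ) where

  open AbelianGroup G
  open import Algebra.Properties.AbelianGroup G using (⁻¹-anti-homo‿-)
  open import Algebra.Solver.CommutativeMonoid commutativeMonoid using (solve; _⊕_; _⊜_)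
  open import Relation.Binary.Reasoning.Setoid setoid

  -- both sides equal p₁ − p₂ − p₃ + p₄ once the q's cancel
  jacobi-regroup : ∀ p₁ p₂ p₃ p₄ q₁ q₂ →
                   (p₁ - p₂) - (p₃ - p₄) ≈ ((p₁ - q₁) - (q₂ - p₄)) - ((p₂ - q₂) - (q₁ - p₃))
  jacobi-regroup p₁ p₂ p₃ p₄ q₁ q₂ = sym (begin
    ((p₁ - q₁) - (q₂ - p₄)) - ((p₂ - q₂) - (q₁ - p₃))
      ≈⟨ ∙-cong (∙-congˡ (⁻¹-anti-homo‿- q₂ p₄))
                (trans (⁻¹-anti-homo‿- _ _) (∙-congˡ (⁻¹-anti-homo‿- p₂ q₂))) ⟩
    ((p₁ - q₁) ∙ (p₄ - q₂)) ∙ ((q₁ - p₃) ∙ (q₂ - p₂))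
      ≈⟨ solve 8 (λ a b c d e f g k → ((a ⊕ b) ⊕ (c ⊕ d)) ⊕ ((e ⊕ f) ⊕ (g ⊕ k))
                                     ⊜ ((a ⊕ k) ⊕ (c ⊕ f)) ⊕ ((e ⊕ b) ⊕ (g ⊕ d)))
               refl p₁ (q₁ ⁻¹) p₄ (q₂ ⁻¹) q₁ (p₃ ⁻¹) q₂ (p₂ ⁻¹) ⟩
    ((p₁ - p₂) ∙ (p₄ - p₃)) ∙ ((q₁ - q₁) ∙ (q₂ - q₂))
      ≈⟨ ∙-congˡ (trans (∙-cong (inverseʳ q₁) (inverseʳ q₂)) (identityʳ ε)) ⟩
    ((p₁ - p₂) ∙ (p₄ - p₃)) ∙ ε
      ≈⟨ identityʳ _ ⟩
    (p₁ - p₂) ∙ (p₄ - p₃)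
      ≈⟨ ∙-congˡ (⁻¹-anti-homo‿- p₃ p₄) ⟨
    (p₁ - p₂) - (p₃ - p₄) ∎)

module FreeAlgebra {c ℓ} (K : CommutativeRing c ℓ) (n : ℕ) where

  open CommutativeRing K
  open import Algebra.Properties.Ring ring using (-1*x≈-x; x[y-z]≈xy-xz)
  open import Algebra.Properties.AbelianGroup +-abelianGroup using (⁻¹-∙-comm)
  open import Algebra.Properties.CommutativeSemigroup +-commutativeSemigroup using (interchange)
  open import Algebra.Properties.CommutativeSemigroup *-commutativeSemigroup using (x∙yz≈y∙xz)
  open import Algebra.Properties.CommutativeMonoid.Sum +-commutativeMonoid using (sum)
  open SumProperties +-commutativeMonoid
  open AbelianGroupProperties +-abelianGroup
  open import Relation.Binary.Reasoning.Setoid setoid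

  infix  4 _≈ₚ_ _≋_
  infixl 6 _+ₚ_ _−ₚ_
  infixl 7 _*ₚ_
  infixr 8 _·ₚ_

  K⟨A⟩ : Set c
  K⟨A⟩ = Poly K n

  coeff : K⟨A⟩ → Word n → Carrier
  coeff = D.coeff K n

  _≈ₚ_ : K⟨A⟩ → K⟨A⟩ → Set ℓ
  _≈ₚ_ = D._≈ₚ_ K n

  zeroₚ : K⟨A⟩
  zeroₚ = D.zeroₚ K n

  letter : Fin n → K⟨A⟩
  letter a = D.word K n (a ∷ [])

  _+ₚ_ : K⟨A⟩ → K⟨A⟩ → K⟨A⟩
  _+ₚ_ = D._+ₚ_ K n

  _·ₚ_ : Carrier → K⟨A⟩ → K⟨A⟩
  _·ₚ_ = D._·ₚ_ K n

  -- chosen so that bracket P Q is definitionally P *ₚ Q −ₚ Q *ₚ P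
  _−ₚ_ : K⟨A⟩ → K⟨A⟩ → K⟨A⟩
  P −ₚ Q = P +ₚ (- 1#) ·ₚ Q

  _*ₚ_ : K⟨A⟩ → K⟨A⟩ → K⟨A⟩
  _*ₚ_ = D._*ₚ_ K n

  bracket : K⟨A⟩ → K⟨A⟩ → K⟨A⟩
  bracket = D.bracket K n

  ⟪_,_⟫ : K⟨A⟩ → K⟨A⟩ → Carrier
  ⟪_,_⟫ = D.⟪_,_⟫ K n

  lAux : K⟨A⟩ → Word n → K⟨A⟩
  lAux = D.lAux K n

  l : Word n → K⟨A⟩
  l = D.l K n

  lstarWord : Word n → K⟨A⟩
  lstarWord = D.lstarWord K n

  lstar : K⟨A⟩ → K⟨A⟩
  lstar = D.lstar K n

  linExt : (Word n → Carrier) → K⟨A⟩ → Carrier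
  linExt h []            = 0#
  linExt h ((d , u) ∷ P) = d * h u + linExt h P

  linExt-cong : ∀ {g h} P → (∀ u → g u ≈ h u) → linExt g P ≈ linExt h P
  linExt-cong []            g≈h = refl
  linExt-cong ((d , u) ∷ P) g≈h = +-cong (*-congˡ (g≈h u)) (linExt-cong P g≈h)

  linExt-zero : ∀ {h} P → (∀ u → h u ≈ 0#) → linExt h P ≈ 0#
  linExt-zero []            h≈0 = refl
  linExt-zero ((d , u) ∷ P) h≈0 =
    trans (+-cong (trans (*-congˡ (h≈0 u)) (zeroʳ d)) (linExt-zero P h≈0)) (+-identityʳ 0#)

  linExt-+ : ∀ g h P → linExt (λ u → g u + h u) P ≈ linExt g P + linExt h P
  linExt-+ g h []            = sym (+-identityʳ 0#)
  linExt-+ g h ((d , u) ∷ P) =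
    trans (+-cong (distribˡ d (g u) (h u)) (linExt-+ g h P)) (interchange _ _ _ _)

  linExt-* : ∀ d h P → linExt (λ u → d * h u) P ≈ d * linExt h P
  linExt-* d h []            = sym (zeroʳ d)
  linExt-* d h ((e , u) ∷ P) =
    trans (+-cong (x∙yz≈y∙xz e d (h u)) (linExt-* d h P)) (sym (distribˡ d _ _))

  linExt-+ₚ : ∀ h P Q → linExt h (P +ₚ Q) ≈ linExt h P + linExt h Q
  linExt-+ₚ h []            Q = sym (+-identityˡ _)
  linExt-+ₚ h ((d , u) ∷ P) Q = trans (+-congˡ (linExt-+ₚ h P Q)) (sym (+-assoc _ _ _))

  linExt-·ₚ : ∀ h d P → linExt h (d ·ₚ P) ≈ d * linExt h P
  linExt-·ₚ h d []            = sym (zeroʳ d)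
  linExt-·ₚ h d ((e , u) ∷ P) =
    trans (+-cong (*-assoc d e (h u)) (linExt-·ₚ h d P)) (sym (distribˡ d _ _))

  linExt-−ₚ : ∀ h P Q → linExt h (P −ₚ Q) ≈ linExt h P - linExt h Q
  linExt-−ₚ h P Q = trans (linExt-+ₚ h P _) (+-congˡ (trans (linExt-·ₚ h (- 1#) Q) (-1*x≈-x _)))

  linExt-comm : ∀ P Q (g : Word n → Word n → Carrier) →
                linExt (λ u → linExt (g u) Q) P ≈ linExt (λ v → linExt (λ u → g u v) P) Q
  linExt-comm []            Q g = sym (linExt-zero Q (λ _ → refl))
  linExt-comm ((d , u) ∷ P) Q g =
    sym (trans (linExt-+ _ _ Q) (+-cong (linExt-* d (g u) Q) (sym (linExt-comm P Q g))))

  linExt-*ₚ : ∀ h P Q → linExt h (P *ₚ Q) ≈ linExt (λ u → linExt (λ v → h (u ++ v)) Q) P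
  linExt-*ₚ h []            Q = refl
  linExt-*ₚ h ((d , u) ∷ P) Q =
    trans (linExt-+ₚ h (map (prefix d u) Q) (P *ₚ Q)) (+-cong (linExt-prefix Q) (linExt-*ₚ h P Q))
    where
    prefix : Carrier → Word n → Carrier × Word n → Carrier × Word n
    prefix d u (e , v) = (d * e , u ++ v)
    linExt-prefix : ∀ Q → linExt h (map (prefix d u) Q) ≈ d * linExt (λ v → h (u ++ v)) Q
    linExt-prefix []            = sym (zeroʳ d)
    linExt-prefix ((e , v) ∷ Q) =
      trans (+-cong (*-assoc d e _) (linExt-prefix Q)) (sym (distribˡ d _ _))

  ⟪⟫≡linExt-coeff : ∀ P Q → ⟪ P , Q ⟫ ≡ linExt (coeff Q) P
  ⟪⟫≡linExt-coeff []            Q = ≡.refl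
  ⟪⟫≡linExt-coeff ((d , u) ∷ P) Q = ≡.cong (d * coeff Q u +_) (⟪⟫≡linExt-coeff P Q)

  δ : Word n → Word n → Carrier
  δ w u = if does (u ≟w w) then 1# else 0#

  coeff≈linExt-δ : ∀ P w → coeff P w ≈ linExt (δ w) P
  coeff≈linExt-δ []            w = refl
  coeff≈linExt-δ ((d , u) ∷ P) w = +-cong (select (does (u ≟w w))) (coeff≈linExt-δ P w)
    where
    select : ∀ b → (if b then d else 0#) ≈ d * (if b then 1# else 0#)
    select true  = sym (*-identityʳ d)
    select false = sym (zeroʳ d)

  coeff-+ₚ : ∀ P Q w → coeff (P +ₚ Q) w ≈ coeff P w + coeff Q w
  coeff-+ₚ P Q w = begin
    coeff (P +ₚ Q) w              ≈⟨ coeff≈linExt-δ (P +ₚ Q) w ⟩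
    linExt (δ w) (P +ₚ Q)         ≈⟨ linExt-+ₚ (δ w) P Q ⟩
    linExt (δ w) P + linExt (δ w) Q ≈⟨ +-cong (coeff≈linExt-δ P w) (coeff≈linExt-δ Q w) ⟨
    coeff P w + coeff Q w         ∎

  coeff-·ₚ : ∀ d P w → coeff (d ·ₚ P) w ≈ d * coeff P w
  coeff-·ₚ d P w = begin
    coeff (d ·ₚ P) w      ≈⟨ coeff≈linExt-δ (d ·ₚ P) w ⟩
    linExt (δ w) (d ·ₚ P) ≈⟨ linExt-·ₚ (δ w) d P ⟩
    d * linExt (δ w) P    ≈⟨ *-congˡ (coeff≈linExt-δ P w) ⟨
    d * coeff P w         ∎

  coeff-*ₚ : ∀ P Q w → coeff (P *ₚ Q) w ≈ linExt (λ u → linExt (λ v → δ w (u ++ v)) Q) P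
  coeff-*ₚ P Q w = trans (coeff≈linExt-δ (P *ₚ Q) w) (linExt-*ₚ (δ w) P Q)

  -- If r is the only possible f-preimage of w, then δ w ∘ f is δ r or 0; with f = (u ++_) or
  -- (_++ v) this is what lets coefficientwise equality pass through products.
  linExt-δ∘-cong : ∀ (f : Word n → Word n) w r → (∀ u → f u ≡ w → u ≡ r) →
                   ∀ {P Q} → P ≈ₚ Q → linExt (δ w ∘ f) P ≈ linExt (δ w ∘ f) Q
  linExt-δ∘-cong f w r only-r {P} {Q} P≈Q with f r ≟w w
  ... | yes fr≡w = begin
    linExt (δ w ∘ f) P ≈⟨ linExt-cong P δ∘f≈δr ⟩
    linExt (δ r) P     ≈⟨ coeff≈linExt-δ P r ⟨
    coeff P r          ≈⟨ P≈Q r ⟩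
    coeff Q r          ≈⟨ coeff≈linExt-δ Q r ⟩
    linExt (δ r) Q     ≈⟨ linExt-cong Q δ∘f≈δr ⟨
    linExt (δ w ∘ f) Q ∎
    where
    δ∘f≈δr : ∀ u → δ w (f u) ≈ δ r u
    δ∘f≈δr u with f u ≟w w | u ≟w r
    ... | yes _    | yes _   = refl
    ... | yes fu≡w | no u≢r  = contradiction (only-r u fu≡w) u≢r
    ... | no fu≢w  | yes u≡r = contradiction (≡.trans (≡.cong f u≡r) fr≡w) fu≢w
    ... | no _     | no _    = refl
  ... | no fr≢w = trans (linExt-zero P δ∘f≈0) (sym (linExt-zero Q δ∘f≈0))
    where
    δ∘f≈0 : ∀ u → δ w (f u) ≈ 0#
    δ∘f≈0 u with f u ≟w w
    ... | yes fu≡w = contradiction (≡.subst (λ x → f x ≡ w) (only-r u fu≡w) fu≡w) fr≢w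
    ... | no _     = refl

  +ₚ-cong : ∀ {P P′ Q Q′} → P ≈ₚ P′ → Q ≈ₚ Q′ → P +ₚ Q ≈ₚ P′ +ₚ Q′
  +ₚ-cong {P} {P′} {Q} {Q′} P≈P′ Q≈Q′ w =
    trans (coeff-+ₚ P Q w) (trans (+-cong (P≈P′ w) (Q≈Q′ w)) (sym (coeff-+ₚ P′ Q′ w)))

  ·ₚ-congˡ : ∀ d {P P′} → P ≈ₚ P′ → d ·ₚ P ≈ₚ d ·ₚ P′
  ·ₚ-congˡ d {P} {P′} P≈P′ w =
    trans (coeff-·ₚ d P w) (trans (*-congˡ (P≈P′ w)) (sym (coeff-·ₚ d P′ w)))

  *ₚ-congˡ : ∀ P {Q Q′} → Q ≈ₚ Q′ → P *ₚ Q ≈ₚ P *ₚ Q′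
  *ₚ-congˡ P {Q} {Q′} Q≈Q′ w = begin
    coeff (P *ₚ Q) w                                 ≈⟨ coeff-*ₚ P Q w ⟩
    linExt (λ u → linExt (λ v → δ w (u ++ v)) Q) P
      ≈⟨ linExt-cong P (λ u → linExt-δ∘-cong (u ++_) w _ (λ _ → ++≡⇒≡drop u) {Q} {Q′} Q≈Q′) ⟩
    linExt (λ u → linExt (λ v → δ w (u ++ v)) Q′) P ≈⟨ coeff-*ₚ P Q′ w ⟨
    coeff (P *ₚ Q′) w                                ∎

  *ₚ-congʳ : ∀ {P P′} Q → P ≈ₚ P′ → P *ₚ Q ≈ₚ P′ *ₚ Q
  *ₚ-congʳ {P} {P′} Q P≈P′ w = begin
    coeff (P *ₚ Q) w                                 ≈⟨ coeff-*ₚ P Q w ⟩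
    linExt (λ u → linExt (λ v → δ w (u ++ v)) Q) P   ≈⟨ linExt-comm P Q _ ⟩
    linExt (λ v → linExt (λ u → δ w (u ++ v)) P) Q
      ≈⟨ linExt-cong Q (λ v → linExt-δ∘-cong (_++ v) w _ (λ _ → ++≡⇒≡take v) {P} {P′} P≈P′) ⟩
    linExt (λ v → linExt (λ u → δ w (u ++ v)) P′) Q  ≈⟨ linExt-comm P′ Q _ ⟨
    linExt (λ u → linExt (λ v → δ w (u ++ v)) Q) P′  ≈⟨ coeff-*ₚ P′ Q w ⟨
    coeff (P′ *ₚ Q) w                                ∎

  *ₚ-cong : ∀ {P P′ Q Q′} → P ≈ₚ P′ → Q ≈ₚ Q′ → P *ₚ Q ≈ₚ P′ *ₚ Q′
  *ₚ-cong {P} {P′} {Q} {Q′} P≈P′ Q≈Q′ w =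
    trans (*ₚ-congʳ {P} {P′} Q P≈P′ w) (*ₚ-congˡ P′ {Q} {Q′} Q≈Q′ w)

  bracket-cong : ∀ {P P′ Q Q′} → P ≈ₚ P′ → Q ≈ₚ Q′ → bracket P Q ≈ₚ bracket P′ Q′
  bracket-cong {P} {P′} {Q} {Q′} P≈P′ Q≈Q′ =
    +ₚ-cong {P *ₚ Q} {P′ *ₚ Q′} (*ₚ-cong {P} {P′} {Q} {Q′} P≈P′ Q≈Q′)
      (·ₚ-congˡ (- 1#) {Q *ₚ P} {Q′ *ₚ P′} (*ₚ-cong {Q} {Q′} {P} {P′} Q≈Q′ P≈P′))

  -- A polynomial is a list of terms in which a word may repeat, so identities of K⟨A⟩ are
  -- proved against every linear functional at once; the functionals δ w recover ≈ₚ.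
  record _≋_ (P Q : K⟨A⟩) : Set (c ⊔ ℓ) where
    constructor ≋-intro
    field linExt-≈ : ∀ h → linExt h P ≈ linExt h Q
  open _≋_

  ≋-refl : ∀ {P} → P ≋ P
  ≋-refl = ≋-intro λ _ → refl

  ≋-sym : ∀ {P Q} → P ≋ Q → Q ≋ P
  ≋-sym P≋Q = ≋-intro λ h → sym (linExt-≈ P≋Q h)

  ≋-trans : ∀ {P Q R} → P ≋ Q → Q ≋ R → P ≋ R
  ≋-trans P≋Q Q≋R = ≋-intro λ h → trans (linExt-≈ P≋Q h) (linExt-≈ Q≋R h)

  ≋⇒≈ₚ : ∀ {P Q} → P ≋ Q → P ≈ₚ Q
  ≋⇒≈ₚ {P} {Q} P≋Q w =
    trans (coeff≈linExt-δ P w) (trans (linExt-≈ P≋Q (δ w)) (sym (coeff≈linExt-δ Q w)))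

  +ₚ-cong-≋ : ∀ {P P′ Q Q′} → P ≋ P′ → Q ≋ Q′ → P +ₚ Q ≋ P′ +ₚ Q′
  +ₚ-cong-≋ {P} {P′} {Q} {Q′} P≋P′ Q≋Q′ = ≋-intro λ h →
    trans (linExt-+ₚ h P Q)
          (trans (+-cong (linExt-≈ P≋P′ h) (linExt-≈ Q≋Q′ h)) (sym (linExt-+ₚ h P′ Q′)))

  ·ₚ-congˡ-≋ : ∀ d {P P′} → P ≋ P′ → d ·ₚ P ≋ d ·ₚ P′
  ·ₚ-congˡ-≋ d {P} {P′} P≋P′ = ≋-intro λ h →
    trans (linExt-·ₚ h d P) (trans (*-congˡ (linExt-≈ P≋P′ h)) (sym (linExt-·ₚ h d P′)))

  −ₚ-cong-≋ : ∀ {P P′ Q Q′} → P ≋ P′ → Q ≋ Q′ → P −ₚ Q ≋ P′ −ₚ Q′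
  −ₚ-cong-≋ P≋P′ Q≋Q′ = +ₚ-cong-≋ P≋P′ (·ₚ-congˡ-≋ (- 1#) Q≋Q′)

  −ₚ-interchange : ∀ P Q R S → (P +ₚ Q) −ₚ (R +ₚ S) ≋ (P −ₚ R) +ₚ (Q −ₚ S)
  −ₚ-interchange P Q R S = ≋-intro λ h → begin
    linExt h ((P +ₚ Q) −ₚ (R +ₚ S))
      ≈⟨ trans (linExt-−ₚ h (P +ₚ Q) (R +ₚ S))
               (+-cong (linExt-+ₚ h P Q) (-‿cong (linExt-+ₚ h R S))) ⟩
    (linExt h P + linExt h Q) - (linExt h R + linExt h S)
      ≈⟨ +-congˡ (⁻¹-∙-comm (linExt h R) (linExt h S)) ⟨
    (linExt h P + linExt h Q) + (- linExt h R + - linExt h S)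
      ≈⟨ interchange _ _ _ _ ⟩
    (linExt h P - linExt h R) + (linExt h Q - linExt h S)
      ≈⟨ trans (linExt-+ₚ h (P −ₚ R) (Q −ₚ S)) (+-cong (linExt-−ₚ h P R) (linExt-−ₚ h Q S)) ⟨
    linExt h ((P −ₚ R) +ₚ (Q −ₚ S)) ∎

  ·ₚ-distrib-−ₚ : ∀ d P Q → d ·ₚ P −ₚ d ·ₚ Q ≋ d ·ₚ (P −ₚ Q)
  ·ₚ-distrib-−ₚ d P Q = ≋-intro λ h → begin
    linExt h (d ·ₚ P −ₚ d ·ₚ Q)
      ≈⟨ trans (linExt-−ₚ h (d ·ₚ P) (d ·ₚ Q))
               (+-cong (linExt-·ₚ h d P) (-‿cong (linExt-·ₚ h d Q))) ⟩
    d * linExt h P - d * linExt h Q ≈⟨ x[y-z]≈xy-xz d _ _ ⟨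
    d * (linExt h P - linExt h Q)   ≈⟨ trans (linExt-·ₚ h d (P −ₚ Q)) (*-congˡ (linExt-−ₚ h P Q)) ⟨
    linExt h (d ·ₚ (P −ₚ Q))        ∎

  *ₚ-zeroʳ : ∀ P → P *ₚ zeroₚ ≋ zeroₚ
  *ₚ-zeroʳ P = ≋-intro λ h → trans (linExt-*ₚ h P zeroₚ) (linExt-zero P (λ _ → refl))

  *ₚ-assoc : ∀ P Q R → (P *ₚ Q) *ₚ R ≋ P *ₚ (Q *ₚ R)
  *ₚ-assoc P Q R = ≋-intro λ h → begin
    linExt h ((P *ₚ Q) *ₚ R)
      ≈⟨ trans (linExt-*ₚ h (P *ₚ Q) R) (linExt-*ₚ _ P Q) ⟩
    linExt (λ x → linExt (λ y → linExt (λ z → h ((x ++ y) ++ z)) R) Q) P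
      ≈⟨ linExt-cong P (λ x → linExt-cong Q (λ y → linExt-cong R (λ z →
           reflexive (≡.cong h (++-assoc x y z))))) ⟩
    linExt (λ x → linExt (λ y → linExt (λ z → h (x ++ (y ++ z))) R) Q) P
      ≈⟨ trans (linExt-*ₚ h P (Q *ₚ R)) (linExt-cong P (λ x → linExt-*ₚ _ Q R)) ⟨
    linExt h (P *ₚ (Q *ₚ R)) ∎

  *ₚ-distribʳ-+ₚ : ∀ P P′ Q → (P +ₚ P′) *ₚ Q ≋ P *ₚ Q +ₚ P′ *ₚ Q
  *ₚ-distribʳ-+ₚ P P′ Q = ≋-intro λ h → begin
    linExt h ((P +ₚ P′) *ₚ Q)
      ≈⟨ trans (linExt-*ₚ h (P +ₚ P′) Q) (linExt-+ₚ _ P P′) ⟩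
    linExt (λ u → linExt (h ∘ (u ++_)) Q) P + linExt (λ u → linExt (h ∘ (u ++_)) Q) P′
      ≈⟨ +-cong (linExt-*ₚ h P Q) (linExt-*ₚ h P′ Q) ⟨
    linExt h (P *ₚ Q) + linExt h (P′ *ₚ Q)
      ≈⟨ linExt-+ₚ h (P *ₚ Q) (P′ *ₚ Q) ⟨
    linExt h (P *ₚ Q +ₚ P′ *ₚ Q) ∎

  *ₚ-distribˡ-+ₚ : ∀ P Q Q′ → P *ₚ (Q +ₚ Q′) ≋ P *ₚ Q +ₚ P *ₚ Q′
  *ₚ-distribˡ-+ₚ P Q Q′ = ≋-intro λ h → begin
    linExt h (P *ₚ (Q +ₚ Q′))
      ≈⟨ linExt-*ₚ h P (Q +ₚ Q′) ⟩
    linExt (λ u → linExt (h ∘ (u ++_)) (Q +ₚ Q′)) P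
      ≈⟨ linExt-cong P (λ u → linExt-+ₚ (h ∘ (u ++_)) Q Q′) ⟩
    linExt (λ u → linExt (h ∘ (u ++_)) Q + linExt (h ∘ (u ++_)) Q′) P
      ≈⟨ linExt-+ _ _ P ⟩
    linExt (λ u → linExt (h ∘ (u ++_)) Q) P + linExt (λ u → linExt (h ∘ (u ++_)) Q′) P
      ≈⟨ +-cong (linExt-*ₚ h P Q) (linExt-*ₚ h P Q′) ⟨
    linExt h (P *ₚ Q) + linExt h (P *ₚ Q′)
      ≈⟨ linExt-+ₚ h (P *ₚ Q) (P *ₚ Q′) ⟨
    linExt h (P *ₚ Q +ₚ P *ₚ Q′) ∎

  ·ₚ-*ₚ : ∀ d P Q → (d ·ₚ P) *ₚ Q ≋ d ·ₚ (P *ₚ Q)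
  ·ₚ-*ₚ d P Q = ≋-intro λ h → begin
    linExt h ((d ·ₚ P) *ₚ Q)                       ≈⟨ linExt-*ₚ h (d ·ₚ P) Q ⟩
    linExt (λ u → linExt (h ∘ (u ++_)) Q) (d ·ₚ P) ≈⟨ linExt-·ₚ _ d P ⟩
    d * linExt (λ u → linExt (h ∘ (u ++_)) Q) P    ≈⟨ *-congˡ (linExt-*ₚ h P Q) ⟨
    d * linExt h (P *ₚ Q)                          ≈⟨ linExt-·ₚ h d (P *ₚ Q) ⟨
    linExt h (d ·ₚ (P *ₚ Q))                       ∎

  *ₚ-·ₚ : ∀ d P Q → P *ₚ (d ·ₚ Q) ≋ d ·ₚ (P *ₚ Q)
  *ₚ-·ₚ d P Q = ≋-intro λ h → begin
    linExt h (P *ₚ (d ·ₚ Q))                       ≈⟨ linExt-*ₚ h P (d ·ₚ Q) ⟩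
    linExt (λ u → linExt (h ∘ (u ++_)) (d ·ₚ Q)) P
      ≈⟨ linExt-cong P (λ u → linExt-·ₚ (h ∘ (u ++_)) d Q) ⟩
    linExt (λ u → d * linExt (h ∘ (u ++_)) Q) P    ≈⟨ linExt-* d _ P ⟩
    d * linExt (λ u → linExt (h ∘ (u ++_)) Q) P    ≈⟨ *-congˡ (linExt-*ₚ h P Q) ⟨
    d * linExt h (P *ₚ Q)                          ≈⟨ linExt-·ₚ h d (P *ₚ Q) ⟨
    linExt h (d ·ₚ (P *ₚ Q))                       ∎

  *ₚ-distribˡ-−ₚ : ∀ P Q R → P *ₚ (Q −ₚ R) ≋ P *ₚ Q −ₚ P *ₚ R
  *ₚ-distribˡ-−ₚ P Q R = ≋-trans (*ₚ-distribˡ-+ₚ P Q _) (+ₚ-cong-≋ ≋-refl (*ₚ-·ₚ (- 1#) P R))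

  *ₚ-distribʳ-−ₚ : ∀ P Q R → (P −ₚ Q) *ₚ R ≋ P *ₚ R −ₚ Q *ₚ R
  *ₚ-distribʳ-−ₚ P Q R = ≋-trans (*ₚ-distribʳ-+ₚ P _ R) (+ₚ-cong-≋ ≋-refl (·ₚ-*ₚ (- 1#) Q R))

  bracket-zeroˡ : ∀ Q → bracket zeroₚ Q ≋ zeroₚ
  bracket-zeroˡ Q = −ₚ-cong-≋ ≋-refl (*ₚ-zeroʳ Q)

  bracket-zeroʳ : ∀ P → bracket P zeroₚ ≋ zeroₚ
  bracket-zeroʳ P = −ₚ-cong-≋ (*ₚ-zeroʳ P) ≋-refl

  bracket-distribʳ-+ₚ : ∀ P P′ Q → bracket (P +ₚ P′) Q ≋ bracket P Q +ₚ bracket P′ Q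
  bracket-distribʳ-+ₚ P P′ Q =
    ≋-trans (−ₚ-cong-≋ (*ₚ-distribʳ-+ₚ P P′ Q) (*ₚ-distribˡ-+ₚ Q P P′))
            (−ₚ-interchange (P *ₚ Q) (P′ *ₚ Q) (Q *ₚ P) (Q *ₚ P′))

  bracket-distribˡ-+ₚ : ∀ P Q Q′ → bracket P (Q +ₚ Q′) ≋ bracket P Q +ₚ bracket P Q′
  bracket-distribˡ-+ₚ P Q Q′ =
    ≋-trans (−ₚ-cong-≋ (*ₚ-distribˡ-+ₚ P Q Q′) (*ₚ-distribʳ-+ₚ Q Q′ P))
            (−ₚ-interchange (P *ₚ Q) (P *ₚ Q′) (Q *ₚ P) (Q′ *ₚ P))

  bracket-·ₚˡ : ∀ d P Q → bracket (d ·ₚ P) Q ≋ d ·ₚ bracket P Q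
  bracket-·ₚˡ d P Q =
    ≋-trans (−ₚ-cong-≋ (·ₚ-*ₚ d P Q) (*ₚ-·ₚ d Q P)) (·ₚ-distrib-−ₚ d (P *ₚ Q) (Q *ₚ P))

  bracket-·ₚʳ : ∀ d P Q → bracket P (d ·ₚ Q) ≋ d ·ₚ bracket P Q
  bracket-·ₚʳ d P Q =
    ≋-trans (−ₚ-cong-≋ (*ₚ-·ₚ d P Q) (·ₚ-*ₚ d Q P)) (·ₚ-distrib-−ₚ d (P *ₚ Q) (Q *ₚ P))

  linExt-jacobi : ∀ h X Z A → linExt h (bracket X (bracket Z A)) ≈
                              linExt h (bracket (bracket X Z) A −ₚ bracket (bracket X A) Z)
  linExt-jacobi h X Z A = begin
    t (bracket X (bracket Z A))
      ≈⟨ t-bracket-bracketʳ X Z A ⟩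
    (xza - xaz) - (zax - azx)
      ≈⟨ jacobi-regroup xza xaz zax azx zxa axz ⟩
    ((xza - zxa) - (axz - azx)) - ((xaz - axz) - (zxa - zax))
      ≈⟨ +-cong (t-bracket-bracketˡ X Z A) (-‿cong (t-bracket-bracketˡ X A Z)) ⟨
    t (bracket (bracket X Z) A) - t (bracket (bracket X A) Z)
      ≈⟨ linExt-−ₚ h (bracket (bracket X Z) A) (bracket (bracket X A) Z) ⟨
    t (bracket (bracket X Z) A −ₚ bracket (bracket X A) Z) ∎
    where
    t : K⟨A⟩ → Carrier
    t = linExt h

    xza xaz zax azx zxa axz : Carrier
    xza = t (X *ₚ (Z *ₚ A))
    xaz = t (X *ₚ (A *ₚ Z))
    zax = t (Z *ₚ (A *ₚ X))
    azx = t (A *ₚ (Z *ₚ X))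
    zxa = t (Z *ₚ (X *ₚ A))
    axz = t (A *ₚ (X *ₚ Z))

    t-*ₚ-bracket : ∀ P Q R → t (P *ₚ bracket Q R) ≈ t (P *ₚ (Q *ₚ R)) - t (P *ₚ (R *ₚ Q))
    t-*ₚ-bracket P Q R = trans (linExt-≈ (*ₚ-distribˡ-−ₚ P (Q *ₚ R) (R *ₚ Q)) h)
                               (linExt-−ₚ h (P *ₚ (Q *ₚ R)) (P *ₚ (R *ₚ Q)))

    t-bracket-*ₚ : ∀ P Q R → t (bracket P Q *ₚ R) ≈ t (P *ₚ (Q *ₚ R)) - t (Q *ₚ (P *ₚ R))
    t-bracket-*ₚ P Q R = trans (linExt-≈ (*ₚ-distribʳ-−ₚ (P *ₚ Q) (Q *ₚ P) R) h)
      (trans (linExt-−ₚ h ((P *ₚ Q) *ₚ R) ((Q *ₚ P) *ₚ R))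
             (+-cong (linExt-≈ (*ₚ-assoc P Q R) h) (-‿cong (linExt-≈ (*ₚ-assoc Q P R) h))))

    t-bracket-bracketʳ : ∀ P Q R → t (bracket P (bracket Q R)) ≈
                         (t (P *ₚ (Q *ₚ R)) - t (P *ₚ (R *ₚ Q))) - (t (Q *ₚ (R *ₚ P)) - t (R *ₚ (Q *ₚ P)))
    t-bracket-bracketʳ P Q R = trans (linExt-−ₚ h (P *ₚ bracket Q R) (bracket Q R *ₚ P))
      (+-cong (t-*ₚ-bracket P Q R) (-‿cong (t-bracket-*ₚ Q R P)))

    t-bracket-bracketˡ : ∀ P Q R → t (bracket (bracket P Q) R) ≈
                         (t (P *ₚ (Q *ₚ R)) - t (Q *ₚ (P *ₚ R))) - (t (R *ₚ (P *ₚ Q)) - t (R *ₚ (Q *ₚ P)))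
    t-bracket-bracketˡ P Q R = trans (linExt-−ₚ h (bracket P Q *ₚ R) (R *ₚ bracket P Q))
      (+-cong (t-bracket-*ₚ P Q R) (-‿cong (t-*ₚ-bracket R P Q)))

  jacobi : ∀ X Z A → bracket X (bracket Z A) ≋ bracket (bracket X Z) A −ₚ bracket (bracket X A) Z
  jacobi X Z A = ≋-intro λ h → linExt-jacobi h X Z A

  data LeftNormedSpan : K⟨A⟩ → Set (c ⊔ ℓ) where
    leftNormed : ∀ v → LeftNormedSpan (l v)
    span-+ₚ    : ∀ {P Q} → LeftNormedSpan P → LeftNormedSpan Q → LeftNormedSpan (P +ₚ Q)
    span-·ₚ    : ∀ {P} d → LeftNormedSpan P → LeftNormedSpan (d ·ₚ P)
    span-≈ₚ    : ∀ {P Q} → P ≈ₚ Q → LeftNormedSpan P → LeftNormedSpan Q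

  span-≋ : ∀ {P Q} → P ≋ Q → LeftNormedSpan P → LeftNormedSpan Q
  span-≋ P≋Q = span-≈ₚ (≋⇒≈ₚ P≋Q)

  lAux-snoc : ∀ Z w a → lAux Z (w ++ a ∷ []) ≡ bracket (lAux Z w) (letter a)
  lAux-snoc Z []      a = ≡.refl
  lAux-snoc Z (b ∷ w) a = lAux-snoc (bracket Z (letter b)) w a

  span-bracket-letter : ∀ a {P} → LeftNormedSpan P → LeftNormedSpan (bracket P (letter a))
  span-bracket-letter a (leftNormed [])      = span-≋ (≋-sym (bracket-zeroˡ (letter a))) (leftNormed [])
  span-bracket-letter a (leftNormed (b ∷ w)) =
    ≡.subst LeftNormedSpan (lAux-snoc (letter b) w a) (leftNormed (b ∷ w ++ a ∷ []))
  span-bracket-letter a (span-+ₚ {P} {Q} P∈ Q∈) =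
    span-≋ (≋-sym (bracket-distribʳ-+ₚ P Q (letter a)))
           (span-+ₚ (span-bracket-letter a P∈) (span-bracket-letter a Q∈))
  span-bracket-letter a (span-·ₚ {P} d P∈) =
    span-≋ (≋-sym (bracket-·ₚˡ d P (letter a))) (span-·ₚ d (span-bracket-letter a P∈))
  span-bracket-letter a (span-≈ₚ {P} {Q} P≈Q P∈) =
    span-≈ₚ (bracket-cong {P} {Q} {letter a} {letter a} P≈Q (λ _ → refl)) (span-bracket-letter a P∈)

  BracketPreservesSpan : K⟨A⟩ → Set (c ⊔ ℓ)
  BracketPreservesSpan Z = ∀ {X} → LeftNormedSpan X → LeftNormedSpan (bracket X Z)

  bracketPreservesSpan-letter : ∀ a {Z} → LeftNormedSpan Z → BracketPreservesSpan Z →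
                                BracketPreservesSpan (bracket Z (letter a))
  bracketPreservesSpan-letter a {Z} Z∈ [-,Z]∈ {X} X∈ =
    span-≋ (≋-sym (jacobi X Z (letter a)))
      (span-+ₚ (span-bracket-letter a ([-,Z]∈ X∈)) (span-·ₚ (- 1#) ([-,Z]∈ (span-bracket-letter a X∈))))

  bracketPreservesSpan-lAux : ∀ w {Z} → LeftNormedSpan Z → BracketPreservesSpan Z →
                              BracketPreservesSpan (lAux Z w)
  bracketPreservesSpan-lAux []      Z∈ [-,Z]∈ = [-,Z]∈
  bracketPreservesSpan-lAux (a ∷ w) Z∈ [-,Z]∈ =
    bracketPreservesSpan-lAux w (span-bracket-letter a Z∈) (bracketPreservesSpan-letter a Z∈ [-,Z]∈)

  bracketPreservesSpan-l : ∀ v → BracketPreservesSpan (l v)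
  bracketPreservesSpan-l []      {X} X∈ = span-≋ (≋-sym (bracket-zeroʳ X)) (leftNormed [])
  bracketPreservesSpan-l (a ∷ w) = bracketPreservesSpan-lAux w (leftNormed (a ∷ [])) (span-bracket-letter a)

  bracketPreservesSpan : ∀ {Y} → LeftNormedSpan Y → BracketPreservesSpan Y
  bracketPreservesSpan (leftNormed v) = bracketPreservesSpan-l v
  bracketPreservesSpan (span-+ₚ {P} {Q} P∈ Q∈) {X} X∈ =
    span-≋ (≋-sym (bracket-distribˡ-+ₚ X P Q))
           (span-+ₚ (bracketPreservesSpan P∈ X∈) (bracketPreservesSpan Q∈ X∈))
  bracketPreservesSpan (span-·ₚ {P} d P∈) {X} X∈ =
    span-≋ (≋-sym (bracket-·ₚʳ d X P)) (span-·ₚ d (bracketPreservesSpan P∈ X∈))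
  bracketPreservesSpan (span-≈ₚ {P} {Q} P≈Q P∈) {X} X∈ =
    span-≈ₚ (bracket-cong {X} {X} {P} {Q} (λ _ → refl) P≈Q) (bracketPreservesSpan P∈ X∈)

  InLie⇒LeftNormedSpan : ∀ {Q} → InLie K n Q → LeftNormedSpan Q
  InLie⇒LeftNormedSpan (gen a)      = leftNormed (a ∷ [])
  InLie⇒LeftNormedSpan zer          = leftNormed []
  InLie⇒LeftNormedSpan (add P∈ Q∈)  = span-+ₚ (InLie⇒LeftNormedSpan P∈) (InLie⇒LeftNormedSpan Q∈)
  InLie⇒LeftNormedSpan (smul d P∈)  = span-·ₚ d (InLie⇒LeftNormedSpan P∈)
  InLie⇒LeftNormedSpan (brk P∈ Q∈)  =
    bracketPreservesSpan (InLie⇒LeftNormedSpan Q∈) (InLie⇒LeftNormedSpan P∈)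
  InLie⇒LeftNormedSpan (resp P≈Q P∈) = span-≈ₚ P≈Q (InLie⇒LeftNormedSpan P∈)

  lAux∈InLie : ∀ w {Z} → InLie K n Z → InLie K n (lAux Z w)
  lAux∈InLie []      Z∈ = Z∈
  lAux∈InLie (a ∷ w) Z∈ = lAux∈InLie w (brk Z∈ (gen a))

  l∈InLie : ∀ v → InLie K n (l v)
  l∈InLie []      = zer
  l∈InLie (a ∷ w) = lAux∈InLie w (gen a)

  ⟪⟫-+ₚ : ∀ P Q R → ⟪ P , Q +ₚ R ⟫ ≈ ⟪ P , Q ⟫ + ⟪ P , R ⟫
  ⟪⟫-+ₚ P Q R = begin
    ⟪ P , Q +ₚ R ⟫                        ≡⟨ ⟪⟫≡linExt-coeff P (Q +ₚ R) ⟩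
    linExt (coeff (Q +ₚ R)) P             ≈⟨ linExt-cong P (coeff-+ₚ Q R) ⟩
    linExt (λ u → coeff Q u + coeff R u) P ≈⟨ linExt-+ (coeff Q) (coeff R) P ⟩
    linExt (coeff Q) P + linExt (coeff R) P
      ≡⟨ ≡.cong₂ _+_ (⟪⟫≡linExt-coeff P Q) (⟪⟫≡linExt-coeff P R) ⟨
    ⟪ P , Q ⟫ + ⟪ P , R ⟫                 ∎

  ⟪⟫-·ₚ : ∀ P d Q → ⟪ P , d ·ₚ Q ⟫ ≈ d * ⟪ P , Q ⟫
  ⟪⟫-·ₚ P d Q = begin
    ⟪ P , d ·ₚ Q ⟫                ≡⟨ ⟪⟫≡linExt-coeff P (d ·ₚ Q) ⟩
    linExt (coeff (d ·ₚ Q)) P     ≈⟨ linExt-cong P (coeff-·ₚ d Q) ⟩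
    linExt (λ u → d * coeff Q u) P ≈⟨ linExt-* d (coeff Q) P ⟩
    d * linExt (coeff Q) P        ≡⟨ ≡.cong (d *_) (⟪⟫≡linExt-coeff P Q) ⟨
    d * ⟪ P , Q ⟫                 ∎

  ⟪⟫-congˡ : ∀ P {Q R} → Q ≈ₚ R → ⟪ P , Q ⟫ ≈ ⟪ P , R ⟫
  ⟪⟫-congˡ P {Q} {R} Q≈R = begin
    ⟪ P , Q ⟫          ≡⟨ ⟪⟫≡linExt-coeff P Q ⟩
    linExt (coeff Q) P ≈⟨ linExt-cong P Q≈R ⟩
    linExt (coeff R) P ≡⟨ ⟪⟫≡linExt-coeff P R ⟨
    ⟪ P , R ⟫          ∎

  ⊥-LeftNormedSpan : ∀ P → (∀ v → ⟪ P , l v ⟫ ≈ 0#) →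
                     ∀ {Q} → LeftNormedSpan Q → ⟪ P , Q ⟫ ≈ 0#
  ⊥-LeftNormedSpan P P⊥l (leftNormed v) = P⊥l v
  ⊥-LeftNormedSpan P P⊥l (span-+ₚ {Q} {R} Q∈ R∈) =
    trans (⟪⟫-+ₚ P Q R)
          (trans (+-cong (⊥-LeftNormedSpan P P⊥l Q∈) (⊥-LeftNormedSpan P P⊥l R∈)) (+-identityʳ 0#))
  ⊥-LeftNormedSpan P P⊥l (span-·ₚ {Q} d Q∈) =
    trans (⟪⟫-·ₚ P d Q) (trans (*-congˡ (⊥-LeftNormedSpan P P⊥l Q∈)) (zeroʳ d))
  ⊥-LeftNormedSpan P P⊥l (span-≈ₚ Q≈R Q∈) =
    trans (sym (⟪⟫-congˡ P Q≈R)) (⊥-LeftNormedSpan P P⊥l Q∈)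

  Homogeneous : ℕ → K⟨A⟩ → Set c
  Homogeneous k = All (λ t → length (proj₂ t) ≡ k)

  homogeneous-·ₚ : ∀ {k} d {P} → Homogeneous k P → Homogeneous k (d ·ₚ P)
  homogeneous-·ₚ d = gmap⁺ id

  homogeneous-*ₚ : ∀ {i j P Q} → Homogeneous i P → Homogeneous j Q → Homogeneous (i ℕ.+ j) (P *ₚ Q)
  homogeneous-*ₚ {i} {j} hP hQ = concat⁺ (gmap⁺ (λ {(d , u)} |u|≡i →
    gmap⁺ (λ {(e , v)} |v|≡j → ≡.trans (length-++ u) (≡.cong₂ ℕ._+_ |u|≡i |v|≡j)) hQ) hP)

  homogeneous-bracket : ∀ {i j P Q} → Homogeneous i P → Homogeneous j Q →
                        Homogeneous (i ℕ.+ j) (bracket P Q)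
  homogeneous-bracket {i} {j} {P} {Q} hP hQ = ++⁺ (homogeneous-*ₚ hP hQ)
    (homogeneous-·ₚ (- 1#) (≡.subst (λ k → Homogeneous k (Q *ₚ P)) (ℕ.+-comm j i)
                                    (homogeneous-*ₚ hQ hP)))

  homogeneous-lAux : ∀ {k Z} w → Homogeneous k Z → Homogeneous (k ℕ.+ length w) (lAux Z w)
  homogeneous-lAux {k} {Z} []      hZ = ≡.subst (λ i → Homogeneous i Z) (≡.sym (ℕ.+-identityʳ k)) hZ
  homogeneous-lAux {k} {Z} (a ∷ w) hZ =
    ≡.subst (λ i → Homogeneous i (lAux (bracket Z (letter a)) w)) (ℕ.+-assoc k 1 (length w))
      (homogeneous-lAux w (homogeneous-bracket hZ (≡.refl ∷ [])))

  homogeneous-l : ∀ v → Homogeneous (length v) (l v)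
  homogeneous-l []      = []
  homogeneous-l (a ∷ w) = homogeneous-lAux w (≡.refl ∷ [])

  coeff-homogeneous : ∀ {k P} w → Homogeneous k P → length w ≢ k → coeff P w ≈ 0#
  coeff-homogeneous w [] |w|≢k = refl
  coeff-homogeneous {P = (d , u) ∷ P} w (|u|≡k ∷ hP) |w|≢k with u ≟w w
  ... | yes ≡.refl = contradiction |u|≡k |w|≢k
  ... | no _       = trans (+-identityˡ _) (coeff-homogeneous w hP |w|≢k)

  graph : (Word n → Carrier) → List (Word n) → K⟨A⟩
  graph g = map (λ v → (g v , v))

  prefixₚ : Fin n → K⟨A⟩ → K⟨A⟩
  prefixₚ a = map (λ t → (proj₁ t , a ∷ proj₂ t))

  coeff-prefixₚ-[] : ∀ a P → coeff (prefixₚ a P) [] ≈ 0#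
  coeff-prefixₚ-[] a []            = refl
  coeff-prefixₚ-[] a ((d , u) ∷ P) = trans (+-identityˡ _) (coeff-prefixₚ-[] a P)

  coeff-prefixₚ-≢ : ∀ {a b} P w → a ≢ b → coeff (prefixₚ a P) (b ∷ w) ≈ 0#
  coeff-prefixₚ-≢ []            w a≢b = refl
  coeff-prefixₚ-≢ {a} {b} ((d , u) ∷ P) w a≢b with a ≟ᶠ b
  ... | yes a≡b = contradiction a≡b a≢b
  ... | no _    = trans (+-identityˡ _) (coeff-prefixₚ-≢ P w a≢b)

  coeff-prefixₚ-≡ : ∀ a P w → coeff (prefixₚ a P) (a ∷ w) ≈ coeff P w
  coeff-prefixₚ-≡ a []            w = refl
  coeff-prefixₚ-≡ a ((d , u) ∷ P) w =
    +-cong (same-test ((a ∷ u) ≟w (a ∷ w)) (u ≟w w)) (coeff-prefixₚ-≡ a P w)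
    where
    same-test : (p : Dec (a ∷ u ≡ a ∷ w)) (q : Dec (u ≡ w)) →
                (if does p then d else 0#) ≈ (if does q then d else 0#)
    same-test (yes _)       (yes _)   = refl
    same-test (yes a∷u≡a∷w) (no u≢w)  = contradiction (∷-injectiveʳ a∷u≡a∷w) u≢w
    same-test (no a∷u≢a∷w)  (yes u≡w) = contradiction (≡.cong (a ∷_) u≡w) a∷u≢a∷w
    same-test (no _)        (no _)    = refl

  graph-map-∷ : ∀ g a L → graph g (map (a ∷_) L) ≡ prefixₚ a (graph (g ∘ (a ∷_)) L)
  graph-map-∷ g a []      = ≡.refl
  graph-map-∷ g a (v ∷ L) = ≡.cong (_ ∷_) (graph-map-∷ g a L)

  coeff-concat-tabulate : ∀ {m} (F : Fin m → K⟨A⟩) w →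
                          coeff (concat (tabulate F)) w ≈ sum (λ i → coeff (F i) w)
  coeff-concat-tabulate {ℕ.zero} F w = refl
  coeff-concat-tabulate {suc m}  F w =
    trans (coeff-+ₚ (F Fin.zero) _ w) (+-congˡ (coeff-concat-tabulate (F ∘ Fin.suc) w))

  graphWithFirstLetter : (Word n → Carrier) → ℕ → Fin n → K⟨A⟩
  graphWithFirstLetter g k a = prefixₚ a (graph (g ∘ (a ∷_)) (wordsOfLength n k))

  graph-wordsOfLength-suc : ∀ k g → graph g (wordsOfLength n (suc k)) ≡
                                    concat (tabulate (graphWithFirstLetter g k))
  graph-wordsOfLength-suc k g =
    ≡.trans (map-concatMap (λ v → (g v , v)) (λ a → map (a ∷_) (wordsOfLength n k)) (allFin n))
      (≡.trans (concatMap-cong (λ a → graph-map-∷ g a (wordsOfLength n k)) (allFin n))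
               (≡.cong concat (map-tabulate id (graphWithFirstLetter g k))))

  coeff-graph-wordsOfLength-suc-[] : ∀ k g → coeff (graph g (wordsOfLength n (suc k))) [] ≈ 0#
  coeff-graph-wordsOfLength-suc-[] k g = begin
    coeff (graph g (wordsOfLength n (suc k))) []
      ≡⟨ ≡.cong (λ P → coeff P []) (graph-wordsOfLength-suc k g) ⟩
    coeff (concat (tabulate (graphWithFirstLetter g k))) []
      ≈⟨ coeff-concat-tabulate (graphWithFirstLetter g k) [] ⟩
    sum (λ a → coeff (graphWithFirstLetter g k a) [])
      ≈⟨ sum-zero (λ a → coeff (graphWithFirstLetter g k a) [])
                  (λ a → coeff-prefixₚ-[] a (graph (g ∘ (a ∷_)) (wordsOfLength n k))) ⟩
    0# ∎

  coeff-graph-wordsOfLength-suc-∷ : ∀ k g b w → coeff (graph g (wordsOfLength n (suc k))) (b ∷ w) ≈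
                                                coeff (graph (g ∘ (b ∷_)) (wordsOfLength n k)) w
  coeff-graph-wordsOfLength-suc-∷ k g b w = begin
    coeff (graph g (wordsOfLength n (suc k))) (b ∷ w)
      ≡⟨ ≡.cong (λ P → coeff P (b ∷ w)) (graph-wordsOfLength-suc k g) ⟩
    coeff (concat (tabulate (graphWithFirstLetter g k))) (b ∷ w)
      ≈⟨ coeff-concat-tabulate (graphWithFirstLetter g k) (b ∷ w) ⟩
    sum (λ a → coeff (graphWithFirstLetter g k a) (b ∷ w))
      ≈⟨ sum-single (λ a → coeff (graphWithFirstLetter g k a) (b ∷ w)) b
                    (λ a a≢b → coeff-prefixₚ-≢ (graph (g ∘ (a ∷_)) (wordsOfLength n k)) w a≢b) ⟩
    coeff (graphWithFirstLetter g k b) (b ∷ w)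
      ≈⟨ coeff-prefixₚ-≡ b (graph (g ∘ (b ∷_)) (wordsOfLength n k)) w ⟩
    coeff (graph (g ∘ (b ∷_)) (wordsOfLength n k)) w ∎

  coeff-graph-wordsOfLength : ∀ k g v → length v ≡ k → coeff (graph g (wordsOfLength n k)) v ≈ g v
  coeff-graph-wordsOfLength ℕ.zero g []      _     = +-identityʳ (g [])
  coeff-graph-wordsOfLength (suc k) g (b ∷ w) |v|≡k =
    trans (coeff-graph-wordsOfLength-suc-∷ k g b w)
          (coeff-graph-wordsOfLength k (g ∘ (b ∷_)) w (ℕ.suc-injective |v|≡k))

  coeff-graph-wordsOfLength-≢ : ∀ k g v → length v ≢ k → coeff (graph g (wordsOfLength n k)) v ≈ 0#
  coeff-graph-wordsOfLength-≢ ℕ.zero  g []      |v|≢k = contradiction ≡.refl |v|≢k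
  coeff-graph-wordsOfLength-≢ ℕ.zero  g (b ∷ w) _     = +-identityʳ 0#
  coeff-graph-wordsOfLength-≢ (suc k) g []      _     = coeff-graph-wordsOfLength-suc-[] k g
  coeff-graph-wordsOfLength-≢ (suc k) g (b ∷ w) |v|≢k =
    trans (coeff-graph-wordsOfLength-suc-∷ k g b w)
          (coeff-graph-wordsOfLength-≢ k (g ∘ (b ∷_)) w (|v|≢k ∘ ≡.cong suc))

  coeff-lstarWord : ∀ u v → coeff (lstarWord u) v ≈ coeff (l v) u
  coeff-lstarWord u v with length v ℕ.≟ length u
  ... | yes |v|≡|u| = coeff-graph-wordsOfLength (length u) (λ v′ → coeff (l v′) u) v |v|≡|u|
  ... | no  |v|≢|u| = trans (coeff-graph-wordsOfLength-≢ (length u) (λ v′ → coeff (l v′) u) v |v|≢|u|)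
                            (sym (coeff-homogeneous u (homogeneous-l v) (|v|≢|u| ∘ ≡.sym)))

  coeff-lstar : ∀ P v → coeff (lstar P) v ≈ ⟪ P , l v ⟫
  coeff-lstar []            v = refl
  coeff-lstar ((d , u) ∷ P) v = trans (coeff-+ₚ (d ·ₚ lstarWord u) (lstar P) v)
    (+-cong (trans (coeff-·ₚ d (lstarWord u) v) (*-congˡ (coeff-lstarWord u v))) (coeff-lstar P v))

lemma2p2 : ∀ {c ℓ} (K : CommutativeRing c ℓ) (n : ℕ) (P : Poly K n) →
    (InKerLstar K n P → InLiePerp K n P) × (InLiePerp K n P → InKerLstar K n P)
lemma2p2 K n P = ker⇒⊥ , ⊥⇒ker
  where
  open CommutativeRing K using (sym; trans)
  open FreeAlgebra K n

  ker⇒⊥ : InKerLstar K n P → InLiePerp K n P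
  ker⇒⊥ P∈ker Q Q∈L = ⊥-LeftNormedSpan P (λ v → trans (sym (coeff-lstar P v)) (P∈ker v))
                                        (InLie⇒LeftNormedSpan Q∈L)

  ⊥⇒ker : InLiePerp K n P → InKerLstar K n P
  ⊥⇒ker P⊥L v = trans (coeff-lstar P v) (P⊥L (l v) (l∈InLie v))
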